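{- Let $V$ be a set of $n$ vertices and let $\{P(v)\}_{v\in V}$ be subsets of $V$ with $|P(v)|\le n^{2/3}$ for all $v$. For $U\subseteq V$ and $u\in V$ let $P^{ -1}(u,U)=\{v\in U: u\in P(v)\}$ and $p^{ -1}(u,U)=|P^{ -1}(u,U)|$. Let $B_0=V$ and for $i\ge0$ let $B_{i+1}=\{u\in V: p^{ -1}(u,B_i)>2n^{2/3}\}$. Then for all $i\ge0$: (1) $B_{i+1}\subseteq B_i$, and (2) $|B_{i+1}|\le\frac12|B_i|$. In particular, $B_i=\emptyset$ for some $i=O(\log n)$. -}

module Defs where

open import Data.Nat using (ℕ; zero; suc; _*_; _^_; _<?_)
open import Data.Bool using (Bool; true; _∧_)
open import Data.Fin using (Fin)
open import Data.Fin.Subset using (Subset; ∣_∣)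
open import Data.Vec using (tabulate; lookup)
open import Relation.Nullary using (does)

Family : ℕ → Set
Family n = Fin n → Subset n

P⁻¹ : ∀ {n} → Family n → Fin n → Subset n → Subset n
P⁻¹ P u U = tabulate (λ v → lookup U v ∧ lookup (P v) u)

p⁻¹ : ∀ {n} → Family n → Fin n → Subset n → ℕ
p⁻¹ P u U = ∣ P⁻¹ P u U ∣

-- |P(v)| ≤ n^{2/3}  ⇔  |P(v)|^3 ≤ n^2   (both sides nonnegative)
-- p > 2 n^{2/3}      ⇔  p^3 > 8 n^2
-- B₀ = V,  B_{i+1} = { u : p⁻¹(u,B_i) > 2 n^{2/3} }
B : ∀ {n} → Family n → ℕ → Subset n
B {n} P zero = tabulate (λ _ → true)
B {n} P (suc i) = tabulate (λ u → does (8 * n ^ 2 <? p⁻¹ P u (B P i) ^ 3))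

{-# OPTIONS --safe #-}
module Submission where

-- Double counting: the sum of p⁻¹(u, Bᵢ) over all u equals the sum of |P(v)| over v ∈ Bᵢ,
-- which is at most |Bᵢ| q for q = max |P(v)| ≤ n^{2/3}.  Every u ∈ Bᵢ₊₁ contributes more
-- than 2 n^{2/3} ≥ 2q, so |Bᵢ₊₁| (2q + 1) ≤ |Bᵢ| q and |Bᵢ₊₁| ≤ |Bᵢ|/2.  Iterating,
-- 2ⁱ |Bᵢ| ≤ n, so B is empty after 1 + ⌊log₂ n⌋ steps.

open import Defs
open import Data.Nat using (ℕ; zero; suc; _*_; _^_; _≤_; _<_; _<?_; _⊔_; z≤n)
open import Data.Nat.Properties
open import Data.Nat.Logarithm using (⌊log₂_⌋; ⌊log₂⌋-mono-≤; ⌊log₂[2^n]⌋≡n)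
open import Algebra.Properties.Semiring.Sum +-*-semiring
  using (sum; sum-syntax; ∑-comm; sum-cong-≗; *-distribˡ-sum; *-distribʳ-sum)
open import Algebra.Properties.CommutativeSemiring.Exp +-*-commutativeSemiring using (^-distrib-*)
open import Data.Bool using (Bool; true; false; _∧_; T)
open import Data.Bool.Properties using (T-≡; T-∧)
open import Data.Fin using (Fin; zero; suc)
open import Data.Fin.Subset using (Subset; _⊆_; _∈_; ∣_∣; ⊥; inside; outside)
open import Data.Fin.Subset.Properties using (p⊆q⇒∣p∣≤∣q∣; ∣p∣≤n)
open import Data.Vec using ([]; _∷_; here; there; tabulate; lookup)
open import Data.Vec.Properties using (lookup∘tabulate; []=⇒lookup; lookup⇒[]=)
open import Data.Product using (_×_; _,_; Σ; ∃-syntax)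
import Data.Product as Product
open import Data.Sum using (inj₁; inj₂)
open import Function using (_∘_; _⇔_; mk⇔; Equivalence)
open import Function.Construct.Composition using (_⇔-∘_)
open import Relation.Nullary using (Dec; does; yes; no; contradiction)
open import Relation.Binary.PropositionalEquality using (_≡_; refl; sym; trans; cong; subst; module ≡-Reasoning)

open Equivalence using (to; from)

χ : Bool → ℕ
χ true  = 1
χ false = 0

χ-∧ : ∀ a b → χ (a ∧ b) ≡ χ a * χ b
χ-∧ true  b = sym (*-identityˡ (χ b))
χ-∧ false b = refl

sum-mono-≤ : ∀ {n} {f g : Fin n → ℕ} → (∀ i → f i ≤ g i) → sum f ≤ sum g
sum-mono-≤ {zero}  f≤g = z≤n
sum-mono-≤ {suc n} f≤g = +-mono-≤ (f≤g zero) (sum-mono-≤ (f≤g ∘ suc))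

sumOver : ∀ {n} → Subset n → (Fin n → ℕ) → ℕ
sumOver {n} p f = ∑[ i < n ] (χ (lookup p i) * f i)

∣p∣≡∑χ : ∀ {n} (p : Subset n) → ∣ p ∣ ≡ ∑[ i < n ] χ (lookup p i)
∣p∣≡∑χ []            = refl
∣p∣≡∑χ (inside  ∷ p) = cong suc (∣p∣≡∑χ p)
∣p∣≡∑χ (outside ∷ p) = ∣p∣≡∑χ p

∣p∣*c≤sum : ∀ {n} {p : Subset n} {c} {f : Fin n → ℕ} → (∀ i → i ∈ p → c ≤ f i) → ∣ p ∣ * c ≤ sum f
∣p∣*c≤sum {p = []}          c≤f = z≤n
∣p∣*c≤sum {p = inside  ∷ p} c≤f =
  +-mono-≤ (c≤f zero here) (∣p∣*c≤sum (λ i → c≤f (suc i) ∘ there))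
∣p∣*c≤sum {p = outside ∷ p} {f = f} c≤f =
  ≤-trans (∣p∣*c≤sum (λ i → c≤f (suc i) ∘ there)) (m≤n+m _ (f zero))

sumOver≤∣p∣*c : ∀ {n} (p : Subset n) {c} {f : Fin n → ℕ} → (∀ i → f i ≤ c) → sumOver p f ≤ ∣ p ∣ * c
sumOver≤∣p∣*c {n} p {c} f≤c = begin
  sumOver p _                     ≤⟨ sum-mono-≤ (λ i → *-monoʳ-≤ (χ (lookup p i)) (f≤c i)) ⟩
  ∑[ i < n ] (χ (lookup p i) * c) ≡⟨ *-distribʳ-sum c (χ ∘ lookup p) ⟨
  (∑[ i < n ] χ (lookup p i)) * c ≡⟨ cong (_* c) (∣p∣≡∑χ p) ⟨
  ∣ p ∣ * c                       ∎
  where open ≤-Reasoning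

maximum : ∀ {n} → (Fin n → ℕ) → ℕ
maximum {zero}  f = 0
maximum {suc n} f = f zero ⊔ maximum (f ∘ suc)

f≤maximum : ∀ {n} (f : Fin n → ℕ) i → f i ≤ maximum f
f≤maximum f zero    = m≤m⊔n _ _
f≤maximum f (suc i) = ≤-trans (f≤maximum (f ∘ suc) i) (m≤n⊔m _ _)

maximum-preserves : ∀ {n} {Q : ℕ → Set} {f : Fin n → ℕ} → Q 0 → (∀ i → Q (f i)) → Q (maximum f)
maximum-preserves {zero}          Q0 Qf = Q0
maximum-preserves {suc n} {Q} {f} Q0 Qf with ⊔-sel (f zero) (maximum (f ∘ suc))
... | inj₁ eq = subst Q (sym eq) (Qf zero)
... | inj₂ eq = subst Q (sym eq) (maximum-preserves {Q = Q} {f ∘ suc} Q0 (Qf ∘ suc))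

∈⇔T-lookup : ∀ {n} {p : Subset n} {x} → x ∈ p ⇔ T (lookup p x)
∈⇔T-lookup {p = p} {x} = mk⇔ (from T-≡ ∘ []=⇒lookup) (lookup⇒[]= x p ∘ to T-≡)

∈-tabulate⇔ : ∀ {n} {f : Fin n → Bool} {x} → x ∈ tabulate f ⇔ T (f x)
∈-tabulate⇔ {f = f} {x} = mk⇔
  (subst T (lookup∘tabulate f x) ∘ to ∈⇔T-lookup)
  (from ∈⇔T-lookup ∘ subst T (sym (lookup∘tabulate f x)))

T[does]⇔ : ∀ {a} {A : Set a} (a? : Dec A) → T (does a?) ⇔ A
T[does]⇔ (yes a) = mk⇔ (λ _ → a) _
T[does]⇔ (no ¬a) = mk⇔ (λ ()) ¬a

m*[1+2q]≤n*q⇒2m≤n : ∀ m n q → m * suc (2 * q) ≤ n * q → 2 * m ≤ n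
m*[1+2q]≤n*q⇒2m≤n zero    n _ _  = z≤n
m*[1+2q]≤n*q⇒2m≤n (suc m) n zero le = contradiction (≤-trans le (≤-reflexive (*-zeroʳ n))) λ ()
m*[1+2q]≤n*q⇒2m≤n m n q@(suc _) le = *-cancelʳ-≤ (2 * m) n q (begin
  2 * m * q       ≡⟨ cong (_* q) (*-comm 2 m) ⟩
  m * 2 * q       ≡⟨ *-assoc m 2 q ⟩
  m * (2 * q)     ≤⟨ *-monoʳ-≤ m (n≤1+n (2 * q)) ⟩
  m * suc (2 * q) ≤⟨ le ⟩
  n * q           ∎)
  where open ≤-Reasoning

q³≤k∧8k<m³⇒2q<m : ∀ {q k m} → q ^ 3 ≤ k → 8 * k < m ^ 3 → 2 * q < m
q³≤k∧8k<m³⇒2q<m {q} {k} {m} q³≤k 8k<m³ = ≰⇒> λ m≤2q → <⇒≱ 8k<m³ (begin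
  m ^ 3       ≤⟨ ^-monoˡ-≤ 3 m≤2q ⟩
  (2 * q) ^ 3 ≡⟨ ^-distrib-* 2 q 3 ⟩
  8 * q ^ 3   ≤⟨ *-monoʳ-≤ 8 q³≤k ⟩
  8 * k       ∎)
  where open ≤-Reasoning

2^i*aᵢ≤a₀ : ∀ (a : ℕ → ℕ) → (∀ i → 2 * a (suc i) ≤ a i) → ∀ i → 2 ^ i * a i ≤ a 0
2^i*aᵢ≤a₀ a halves zero    = ≤-reflexive (*-identityˡ (a 0))
2^i*aᵢ≤a₀ a halves (suc i) = begin
  2 * 2 ^ i * a (suc i)   ≡⟨ cong (_* a (suc i)) (*-comm 2 (2 ^ i)) ⟩
  2 ^ i * 2 * a (suc i)   ≡⟨ *-assoc (2 ^ i) 2 (a (suc i)) ⟩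
  2 ^ i * (2 * a (suc i)) ≤⟨ *-monoʳ-≤ (2 ^ i) (halves i) ⟩
  2 ^ i * a i             ≤⟨ 2^i*aᵢ≤a₀ a halves i ⟩
  a 0                     ∎
  where open ≤-Reasoning

n<2^[1+⌊log₂n⌋] : ∀ n → n < 2 ^ suc ⌊log₂ n ⌋
n<2^[1+⌊log₂n⌋] n = ≰⇒> (1+n≰n ∘ subst (_≤ ⌊log₂ n ⌋) (⌊log₂[2^n]⌋≡n _) ∘ ⌊log₂⌋-mono-≤)

∣p∣≡0⇒p≡⊥ : ∀ {n} (p : Subset n) → ∣ p ∣ ≡ 0 → p ≡ ⊥
∣p∣≡0⇒p≡⊥ []            _       = refl
∣p∣≡0⇒p≡⊥ (outside ∷ p) ∣p∣≡0 = cong (outside ∷_) (∣p∣≡0⇒p≡⊥ p ∣p∣≡0)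

module _ {n} (P : Family n) where

  ∈P⁻¹⇔ : ∀ {u U v} → v ∈ P⁻¹ P u U ⇔ (v ∈ U × u ∈ P v)
  ∈P⁻¹⇔ = mk⇔
    (Product.map (from ∈⇔T-lookup) (from ∈⇔T-lookup) ∘ to T-∧ ∘ to ∈-tabulate⇔)
    (from ∈-tabulate⇔ ∘ from T-∧ ∘ Product.map (to ∈⇔T-lookup) (to ∈⇔T-lookup))

  p⁻¹-mono : ∀ u {U U′} → U ⊆ U′ → p⁻¹ P u U ≤ p⁻¹ P u U′
  p⁻¹-mono u U⊆U′ = p⊆q⇒∣p∣≤∣q∣ (from ∈P⁻¹⇔ ∘ Product.map₁ U⊆U′ ∘ to ∈P⁻¹⇔)

  p⁻¹≡∑ : ∀ u U → p⁻¹ P u U ≡ ∑[ v < n ] (χ (lookup U v) * χ (lookup (P v) u))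
  p⁻¹≡∑ u U = trans (∣p∣≡∑χ (P⁻¹ P u U))
    (sum-cong-≗ λ v → trans (cong χ (lookup∘tabulate _ v)) (χ-∧ (lookup U v) (lookup (P v) u)))

  ∑p⁻¹≡sumOver∣P∣ : ∀ U → ∑[ u < n ] p⁻¹ P u U ≡ sumOver U (∣_∣ ∘ P)
  ∑p⁻¹≡sumOver∣P∣ U = begin
    ∑[ u < n ] p⁻¹ P u U
      ≡⟨ sum-cong-≗ (λ u → p⁻¹≡∑ u U) ⟩
    ∑[ u < n ] ∑[ v < n ] (χ (lookup U v) * χ (lookup (P v) u))
      ≡⟨ ∑-comm (λ u v → χ (lookup U v) * χ (lookup (P v) u)) ⟩
    ∑[ v < n ] ∑[ u < n ] (χ (lookup U v) * χ (lookup (P v) u))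
      ≡⟨ sum-cong-≗ (λ v → *-distribˡ-sum (χ (lookup U v)) (χ ∘ lookup (P v))) ⟨
    ∑[ v < n ] (χ (lookup U v) * ∑[ u < n ] χ (lookup (P v) u))
      ≡⟨ sum-cong-≗ (λ v → cong (χ (lookup U v) *_) (∣p∣≡∑χ (P v))) ⟨
    sumOver U (∣_∣ ∘ P)
      ∎
    where open ≡-Reasoning

  halving : ∀ {U W : Subset n} q → (∀ v → ∣ P v ∣ ≤ q) → (∀ u → u ∈ W → 2 * q < p⁻¹ P u U) →
            2 * ∣ W ∣ ≤ ∣ U ∣
  halving {U} {W} q ∣P∣≤q 2q<p⁻¹ = m*[1+2q]≤n*q⇒2m≤n ∣ W ∣ ∣ U ∣ q (begin
    ∣ W ∣ * suc (2 * q)    ≤⟨ ∣p∣*c≤sum 2q<p⁻¹ ⟩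
    ∑[ u < n ] p⁻¹ P u U   ≡⟨ ∑p⁻¹≡sumOver∣P∣ U ⟩
    sumOver U (∣_∣ ∘ P)    ≤⟨ sumOver≤∣p∣*c U ∣P∣≤q ⟩
    ∣ U ∣ * q              ∎)
    where open ≤-Reasoning

  ∈B-suc⇔ : ∀ {i u} → u ∈ B P (suc i) ⇔ 8 * n ^ 2 < p⁻¹ P u (B P i) ^ 3
  ∈B-suc⇔ {i} {u} = T[does]⇔ (8 * n ^ 2 <? p⁻¹ P u (B P i) ^ 3) ⇔-∘ ∈-tabulate⇔

  B-suc⊆B : ∀ i → B P (suc i) ⊆ B P i
  B-suc⊆B zero    _   = from ∈-tabulate⇔ _
  B-suc⊆B (suc i) {u} = from (∈B-suc⇔ {i}) ∘ threshold-mono ∘ to (∈B-suc⇔ {suc i})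
    where
    threshold-mono : 8 * n ^ 2 < p⁻¹ P u (B P (suc i)) ^ 3 → 8 * n ^ 2 < p⁻¹ P u (B P i) ^ 3
    threshold-mono 8n²<p³ = <-≤-trans 8n²<p³ (^-monoˡ-≤ 3 (p⁻¹-mono u (B-suc⊆B i)))

  module _ (∣P∣³≤n² : ∀ v → ∣ P v ∣ ^ 3 ≤ n ^ 2) where

    B-suc-halves : ∀ i → 2 * ∣ B P (suc i) ∣ ≤ ∣ B P i ∣
    B-suc-halves i = halving {B P i} {B P (suc i)} q (f≤maximum (∣_∣ ∘ P))
      (λ u → q³≤k∧8k<m³⇒2q<m {q} q³≤n² ∘ to (∈B-suc⇔ {i}))
      where
      q : ℕ
      q = maximum (∣_∣ ∘ P)
      q³≤n² : q ^ 3 ≤ n ^ 2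
      q³≤n² = maximum-preserves {Q = λ x → x ^ 3 ≤ n ^ 2} z≤n ∣P∣³≤n²

    B-empty : B P (suc ⌊log₂ n ⌋) ≡ ⊥
    B-empty = ∣p∣≡0⇒p≡⊥ (B P k) (n<1⇒n≡0 (*-cancelˡ-< (2 ^ k) ∣ B P k ∣ 1 (begin-strict
      2 ^ k * ∣ B P k ∣ ≤⟨ 2^i*aᵢ≤a₀ (∣_∣ ∘ B P) B-suc-halves k ⟩
      ∣ B P 0 ∣         ≤⟨ ∣p∣≤n (B P 0) ⟩
      n                 <⟨ n<2^[1+⌊log₂n⌋] n ⟩
      2 ^ k             ≡⟨ *-identityʳ (2 ^ k) ⟨
      2 ^ k * 1         ∎)))
      where
      open ≤-Reasoning
      k : ℕ
      k = suc ⌊log₂ n ⌋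

lemma14 : ((n : ℕ) (P : Family n) → (∀ v → ∣ P v ∣ ^ 3 ≤ n ^ 2) → (i : ℕ) →
            (B P (suc i) ⊆ B P i) × (2 * ∣ B P (suc i) ∣ ≤ ∣ B P i ∣))
          × (Σ ℕ λ C → (n : ℕ) (P : Family n) → (∀ v → ∣ P v ∣ ^ 3 ≤ n ^ 2) →
            ∃[ i ] ((i ≤ C * suc ⌊log₂ n ⌋) × (B P i ≡ ⊥)))
lemma14 = (λ n P ∣P∣³≤n² i → B-suc⊆B P i , B-suc-halves P ∣P∣³≤n² i)
        , 1 , λ n P ∣P∣³≤n² → suc ⌊log₂ n ⌋ , ≤-reflexive (sym (*-identityˡ _)) , B-empty P ∣P∣³≤n²
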